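{- Let $X$ be a finite set with $|X|\ge2$, $T$ a rooted phylogenetic tree on $X$ and $\mathcal{P}$ a partition of $X$. Then $\mathcal{P}$ and $T$ are r-compatible if and only if $|\gamma_{T,\mathcal{P}}(e)|\le 1$ for every $e\in E(T)$.
   Context: A rooted phylogenetic tree $T$ on $X$ is a rooted tree with leaf set $X$ in which every non-leaf vertex has at least two children; $\mathcal{H}(T)=\{L(T(v)):v\in V(T)\}$, where $T(v)$ is the subtree rooted at $v$. A rooted phylogenetic tree $T^*$ on $X$ is a refinement of $T$ if $\mathcal{H}(T)\subseteq\mathcal{H}(T^*)$. For $H\subseteq E(T)$, $\mathcal{F}(T,H)$ is the partition of $X$ into leaf sets of the connected components of $T-H$; $\mathcal{P}$ and $T$ are compatible if $\mathcal{P}=\mathcal{F}(T,H)$ for some $H\subseteq E(T)$, and r-compatible if some refinement of $T$ is compatible with $\mathcal{P}$. The $\mathcal{P}$-coloring $\gamma_{T,\mathcal{P}}:E(T)\to2^{\mathcal{P}}$ is given by $A\in\gamma_{T,\mathcal{P}}(e)$ iff $e$ lies on the path in $T$ between two elements $x,x'\in A$. -}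

module Defs where

open import Data.Nat using (ℕ; _≤_)
open import Data.Fin using (Fin)
open import Data.Bool using (Bool; true)
open import Data.List using (List; length)
open import Data.List.Membership.Propositional using (_∈_)
open import Data.Product using (Σ; _×_; _,_; ∃)
open import Data.Sum using (_⊎_)
open import Relation.Nullary using (¬_)
open import Relation.Binary.PropositionalEquality using (_≡_)
open import Function.Bundles using (_⇔_)

data Tree (n : ℕ) : Set where
  leaf : Fin n → Tree n
  node : List (Tree n) → Tree n

module _ {n : ℕ} where

  -- Vertices of a tree, as positions (paths from the root).
  data Pos : Tree n → Set where
    here  : {t : Tree n} → Pos t
    there : {ts : List (Tree n)} {c : Tree n} → c ∈ ts → Pos c → Pos (node ts)

  subtree : {t : Tree n} → Pos t → Tree n
  subtree {t} here = t
  subtree (there _ p) = subtree p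

  data _∈L_ (x : Fin n) : Tree n → Set where
    inLeaf : x ∈L leaf x
    inNode : {ts : List (Tree n)} {c : Tree n} → c ∈ ts → x ∈L c → x ∈L node ts

  record Phylo (t : Tree n) : Set where
    field
      leafSet   : (x : Fin n) → Σ (Pos t) (λ p → subtree p ≡ leaf x)
      leafUniq  : (x : Fin n) (p q : Pos t) →
                  subtree p ≡ leaf x → subtree q ≡ leaf x → p ≡ q
      twoChildren : (p : Pos t) (ts : List (Tree n)) →
                    subtree p ≡ node ts → 2 ≤ length ts

  -- Edges of a rooted tree correspond bijectively to non-root vertices
  -- (the edge joining a vertex to its parent).
  data NonRoot : {t : Tree n} → Pos t → Set where
    isThere : {ts : List (Tree n)} {c : Tree n} (m : c ∈ ts) (p : Pos c) →
              NonRoot (there m p)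

  Edge : Tree n → Set
  Edge t = Σ (Pos t) (NonRoot {t})

  -- The edge e (above vertex v) lies on the (unique) path in t between the
  -- leaves x and x' iff exactly one of x, x' lies in L(T(v)).
  OnPath : {t : Tree n} → Edge t → Fin n → Fin n → Set
  OnPath (p , _) x x' =
    (x ∈L subtree p × ¬ (x' ∈L subtree p)) ⊎ (¬ (x ∈L subtree p) × x' ∈L subtree p)

  -- Partitions of X are given by block labels P : Fin n → ℕ
  -- (the blocks are the nonempty fibres of P).
  SameBlock : (Fin n → ℕ) → Fin n → Fin n → Set
  SameBlock P x x' = P x ≡ P x'

  SameComponent : (t : Tree n) → (Edge t → Bool) → Fin n → Fin n → Set
  SameComponent t H x x' = (e : Edge t) → H e ≡ true → ¬ OnPath e x x'

  Compatible : Tree n → (Fin n → ℕ) → Set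
  Compatible t P = Σ (Edge t → Bool) λ H →
    (x x' : Fin n) → SameBlock P x x' ⇔ SameComponent t H x x'

  -- t* is a refinement of t: H(t) ⊆ H(t*).
  Refines : Tree n → Tree n → Set
  Refines t* t = (p : Pos t) → Σ (Pos t*) λ q →
    (x : Fin n) → (x ∈L subtree p) ⇔ (x ∈L subtree q)

  RCompatible : Tree n → (Fin n → ℕ) → Set
  RCompatible t P = Σ (Tree n) λ t* → Phylo t* × Refines t* t × Compatible t* P

  -- A ∈ γ_{t,P}(e) for the block A of x: some x₁, x₂ in that block with e on
  -- the path between them.
  InColor : {t : Tree n} → (Fin n → ℕ) → Edge t → Fin n → Set
  InColor P e x = Σ (Fin n) λ x₁ → Σ (Fin n) λ x₂ →
    SameBlock P x x₁ × SameBlock P x x₂ × OnPath e x₁ x₂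

  -- |γ_{t,P}(e)| ≤ 1 : any two blocks in γ_{t,P}(e) coincide.
  ColorAtMostOne : {t : Tree n} → (Fin n → ℕ) → Edge t → Set
  ColorAtMostOne P e = (x y : Fin n) → InColor P e x → InColor P e y → SameBlock P x y

-- Say that a block A of P crosses a cluster C when A meets both C and its complement; then
-- |γ(e)| ≤ 1 says that the cluster below e is crossed by at most one block.
-- If a refinement T* of T is compatible with P via H, two blocks crossing a cluster C of T
-- (a cluster of T* as well) are joined in T* − H through the inside of C, as the clusters of T*
-- form a laminar family; hence they coincide.
-- Conversely, refine T bottom-up: at every vertex u, the children crossed by a block B that
-- does not cross u are gathered under a new vertex. Afterwards the children of each vertex are
-- crossed by at most one common block, and cutting every edge whose cluster is crossed by no
-- block leaves exactly the blocks of P: leaves in different blocks are separated by such an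
-- edge just below their lowest common ancestor.
module Submission where

open import Defs
open import Data.Nat using (ℕ; suc; _≤_; _≤?_; s≤s)
open import Data.Nat.Properties using (_≟_; <⇒≤)
open import Data.Fin using (Fin)
import Data.Fin.Properties as Fin
open import Data.Bool using (Bool; true)
open import Data.List using (List; []; _∷_; _++_; length; map; filter; foldl; allFin)
open import Data.List.Properties using (++-assoc; filter-accept; filter-reject)
open import Data.List.Membership.Propositional using (_∈_)
open import Data.List.Membership.Propositional.Properties
  using (∈-++⁺ˡ; ∈-++⁺ʳ; ∈-++⁻; ∈-filter⁺; ∈-filter⁻; ∈-map⁺; ∈-allFin; ∈-length)
import Data.List.Membership.DecPropositional as DecMembership
open import Data.List.Relation.Unary.Any using (here; there)
import Data.List.Relation.Unary.All as All
open import Data.List.Relation.Unary.AllPairs using ([]; _∷_)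
open import Data.List.Relation.Unary.Unique.Propositional using (Unique)
import Data.List.Relation.Unary.Unique.Propositional.Properties as Unique
open import Data.List.Relation.Binary.Permutation.Propositional
  using (_↭_; ↭-refl; ↭-sym; ↭-trans; ↭-reflexive; ↭⇒↭ₛ)
open import Data.List.Relation.Binary.Permutation.Propositional.Properties
  using (++⁺ˡ; ++⁺; shifts; ∈-resp-↭)
import Data.List.Relation.Binary.Permutation.Setoid.Properties as ↭ₛ
open import Data.Product using (Σ; ∃; _×_; _,_; proj₁; proj₂)
open import Data.Sum using (_⊎_; inj₁; inj₂)
open import Data.Empty using (⊥; ⊥-elim)
open import Relation.Nullary using (¬_; Dec; yes; no)
open import Relation.Nullary.Decidable using (_×-dec_; ¬?; isNo)
open import Relation.Binary.PropositionalEquality using (_≡_; _≢_; refl; sym; trans; cong; subst; setoid)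
open import Function.Bundles using (_⇔_; mk⇔; Equivalence)
open import Function.Properties.Equivalence using () renaming (sym to ⇔-sym)

Unique-resp-↭ : {A : Set} {xs ys : List A} → xs ↭ ys → Unique xs → Unique ys
Unique-resp-↭ {A} p = ↭ₛ.Unique-resp-↭ (setoid A) (↭⇒↭ₛ p)

Unique-++⁻ : {A : Set} (xs : List A) {ys : List A} → Unique (xs ++ ys) → Unique xs × Unique ys
Unique-++⁻ []       u         = [] , u
Unique-++⁻ (x ∷ xs) (x∉ ∷ u) with Unique-++⁻ xs u
... | uxs , uys = All.tabulate (λ m → All.lookup x∉ (∈-++⁺ˡ m)) ∷ uxs , uys

Unique-++-disjoint : {A : Set} {z : A} (xs : List A) {ys : List A} →
                     Unique (xs ++ ys) → z ∈ xs → ¬ z ∈ ys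
Unique-++-disjoint (x ∷ xs) (x∉ ∷ u) (here refl) z∈ys = All.lookup x∉ (∈-++⁺ʳ xs z∈ys) refl
Unique-++-disjoint (x ∷ xs) (x∉ ∷ u) (there z∈xs) = Unique-++-disjoint xs u z∈xs

nonempty⇒∃∈ : {A : Set} {xs : List A} → 1 ≤ length xs → ∃ λ x → x ∈ xs
nonempty⇒∃∈ {xs = x ∷ _} _ = x , here refl

∈-distinct⇒2≤length : {A : Set} {a b : A} {xs : List A} →
                      a ∈ xs → b ∈ xs → a ≢ b → 2 ≤ length xs
∈-distinct⇒2≤length (here refl) (here refl) a≢b = ⊥-elim (a≢b refl)
∈-distinct⇒2≤length (here refl) (there b∈xs) _ = s≤s (∈-length b∈xs)
∈-distinct⇒2≤length (there a∈xs) _           _ = s≤s (∈-length a∈xs)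

module _ {n : ℕ} where

  leaves       : Tree n → List (Fin n)
  forestLeaves : List (Tree n) → List (Fin n)
  leaves (leaf x)  = x ∷ []
  leaves (node ts) = forestLeaves ts
  forestLeaves []       = []
  forestLeaves (t ∷ ts) = leaves t ++ forestLeaves ts

  ∈-forestLeaves⁺ : {x : Fin n} {c : Tree n} {ts : List (Tree n)} →
                    c ∈ ts → x ∈ leaves c → x ∈ forestLeaves ts
  ∈-forestLeaves⁺ {ts = t ∷ ts} (here refl) x∈c = ∈-++⁺ˡ x∈c
  ∈-forestLeaves⁺ {ts = t ∷ ts} (there c∈ts) x∈c = ∈-++⁺ʳ (leaves t) (∈-forestLeaves⁺ c∈ts x∈c)

  ∈L⇒∈leaves : {x : Fin n} {s : Tree n} → x ∈L s → x ∈ leaves s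
  ∈L⇒∈leaves inLeaf         = here refl
  ∈L⇒∈leaves (inNode c∈ts h) = ∈-forestLeaves⁺ c∈ts (∈L⇒∈leaves h)

  ∈leaves⇒∈L       : {x : Fin n} (s : Tree n) → x ∈ leaves s → x ∈L s
  ∈forestLeaves⇒∈L : {x : Fin n} (ts : List (Tree n)) → x ∈ forestLeaves ts → x ∈L node ts
  ∈leaves⇒∈L (leaf y) (here refl) = inLeaf
  ∈leaves⇒∈L (node ts) h         = ∈forestLeaves⇒∈L ts h
  ∈forestLeaves⇒∈L (t ∷ ts) h with ∈-++⁻ (leaves t) h
  ... | inj₁ h₁ = inNode (here refl) (∈leaves⇒∈L t h₁)
  ... | inj₂ h₂ with ∈forestLeaves⇒∈L ts h₂
  ...   | inNode c∈ts x∈c = inNode (there c∈ts) x∈c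

  ∈-forestLeaves⁻ : {x : Fin n} {ts : List (Tree n)} →
                    x ∈ forestLeaves ts → ∃ λ c → c ∈ ts × x ∈L c
  ∈-forestLeaves⁻ {ts = ts} h with ∈forestLeaves⇒∈L ts h
  ... | inNode c∈ts x∈c = _ , c∈ts , x∈c

  ∈L-resp-leaves↭ : {x : Fin n} {s s′ : Tree n} → leaves s ↭ leaves s′ → x ∈L s → x ∈L s′
  ∈L-resp-leaves↭ {s′ = s′} p h = ∈leaves⇒∈L s′ (∈-resp-↭ p (∈L⇒∈leaves h))

  _∈L?_ : (x : Fin n) (s : Tree n) → Dec (x ∈L s)
  x ∈L? s with DecMembership._∈?_ Fin._≟_ x (leaves s)
  ... | yes h = yes (∈leaves⇒∈L s h)
  ... | no h  = no (λ x∈s → h (∈L⇒∈leaves x∈s))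

  extend : {t : Tree n} (p : Pos t) → Pos (subtree p) → Pos t
  extend here        r = r
  extend (there m p) r = there m (extend p r)

  subtree-extend : {t : Tree n} (p : Pos t) (r : Pos (subtree p)) → subtree (extend p r) ≡ subtree r
  subtree-extend here        r = refl
  subtree-extend (there m p) r = subtree-extend p r

  extend-along : {c r : Tree n} (q₀ : Pos c) → subtree q₀ ≡ r → (q : Pos r) →
                 Σ (Pos c) λ q′ → subtree q′ ≡ subtree q
  extend-along q₀ refl q = extend q₀ q , subtree-extend q₀ q

  HasSubtree : List (Tree n) → Tree n → Set
  HasSubtree I r = Σ (Tree n) λ c → c ∈ I × Σ (Pos c) λ q → subtree q ≡ r

  ∈L-subtree⇒∈L : {x : Fin n} {t : Tree n} (p : Pos t) → x ∈L subtree p → x ∈L t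
  ∈L-subtree⇒∈L here        h = h
  ∈L-subtree⇒∈L (there m p) h = inNode m (∈L-subtree⇒∈L p h)

  ∈L⇒leafPos : {x : Fin n} {t : Tree n} → x ∈L t → Σ (Pos t) λ p → subtree p ≡ leaf x
  ∈L⇒leafPos inLeaf = here , refl
  ∈L⇒leafPos (inNode m h) with ∈L⇒leafPos h
  ... | p , e = there m p , e

  leafPos⇒∈L : {x : Fin n} {t : Tree n} (p : Pos t) → subtree p ≡ leaf x → x ∈L t
  leafPos⇒∈L p e = ∈L-subtree⇒∈L p (subst (_ ∈L_) (sym e) inLeaf)

  Unique-child : {c : Tree n} {ts : List (Tree n)} →
                 Unique (forestLeaves ts) → c ∈ ts → Unique (leaves c)
  Unique-child {ts = t ∷ ts} u (here refl) = proj₁ (Unique-++⁻ (leaves t) u)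
  Unique-child {ts = t ∷ ts} u (there m)   = Unique-child (proj₂ (Unique-++⁻ (leaves t) u)) m

  Unique-sharedLeaf⇒≡ : {x : Fin n} {a b : Tree n} {ts : List (Tree n)} → Unique (forestLeaves ts) →
                        a ∈ ts → b ∈ ts → x ∈L a → x ∈L b → a ≡ b
  Unique-sharedLeaf⇒≡ {ts = t ∷ ts} u (here refl) (here refl) _ _ = refl
  Unique-sharedLeaf⇒≡ {ts = t ∷ ts} u (here refl) (there mb) xa xb =
    ⊥-elim (Unique-++-disjoint (leaves t) u (∈L⇒∈leaves xa) (∈-forestLeaves⁺ mb (∈L⇒∈leaves xb)))
  Unique-sharedLeaf⇒≡ {ts = t ∷ ts} u (there ma) (here refl) xa xb =
    ⊥-elim (Unique-++-disjoint (leaves t) u (∈L⇒∈leaves xb) (∈-forestLeaves⁺ ma (∈L⇒∈leaves xa)))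
  Unique-sharedLeaf⇒≡ {ts = t ∷ ts} u (there ma) (there mb) xa xb =
    Unique-sharedLeaf⇒≡ (proj₂ (Unique-++⁻ (leaves t) u)) ma mb xa xb

  UniqueLeafPositions : Tree n → Set
  UniqueLeafPositions s =
    (x : Fin n) (p q : Pos s) → subtree p ≡ leaf x → subtree q ≡ leaf x → p ≡ q

  Unique⇒uniqueLeafPositions : (s : Tree n) → Unique (leaves s) → UniqueLeafPositions s
  Unique⇒uniqueChildPositions :
    (ts : List (Tree n)) → Unique (forestLeaves ts) → {x : Fin n} {c₁ c₂ : Tree n}
    (m₁ : c₁ ∈ ts) (m₂ : c₂ ∈ ts) (p : Pos c₁) (q : Pos c₂) →
    subtree p ≡ leaf x → subtree q ≡ leaf x → there {ts = ts} m₁ p ≡ there m₂ q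
  Unique⇒uniqueLeafPositions s         u x here         here         _  _  = refl
  Unique⇒uniqueLeafPositions (node ts) u x here         (there m q)  () _
  Unique⇒uniqueLeafPositions (node ts) u x (there m p)  here         _  ()
  Unique⇒uniqueLeafPositions (node ts) u x (there m p)  (there m′ q) e₁ e₂ =
    Unique⇒uniqueChildPositions ts u m m′ p q e₁ e₂
  Unique⇒uniqueChildPositions (t ∷ ts) u {x} (here refl) (here refl) p q e₁ e₂ =
    cong (there (here refl))
         (Unique⇒uniqueLeafPositions t (proj₁ (Unique-++⁻ (leaves t) u)) x p q e₁ e₂)
  Unique⇒uniqueChildPositions (t ∷ ts) u (here refl) (there m₂) p q e₁ e₂ =
    ⊥-elim (Unique-++-disjoint (leaves t) u (∈L⇒∈leaves (leafPos⇒∈L p e₁))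
                                            (∈-forestLeaves⁺ m₂ (∈L⇒∈leaves (leafPos⇒∈L q e₂))))
  Unique⇒uniqueChildPositions (t ∷ ts) u (there m₁) (here refl) p q e₁ e₂ =
    ⊥-elim (Unique-++-disjoint (leaves t) u (∈L⇒∈leaves (leafPos⇒∈L q e₂))
                                            (∈-forestLeaves⁺ m₁ (∈L⇒∈leaves (leafPos⇒∈L p e₁))))
  Unique⇒uniqueChildPositions (t ∷ ts) u (there m₁) (there m₂) p q e₁ e₂
    with Unique⇒uniqueChildPositions ts (proj₂ (Unique-++⁻ (leaves t) u)) m₁ m₂ p q e₁ e₂
  ... | refl = refl

  uniqueLeafPositions⇒Unique : (s : Tree n) → UniqueLeafPositions s → Unique (leaves s)
  uniqueLeafPositions⇒Unique (leaf x)       _ = All.[] ∷ []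
  uniqueLeafPositions⇒Unique (node [])      _ = []
  uniqueLeafPositions⇒Unique (node (t ∷ ts)) h =
    Unique.++⁺ (uniqueLeafPositions⇒Unique t head) (uniqueLeafPositions⇒Unique (node ts) tail) disjoint
    where
    head : UniqueLeafPositions t
    head x p q e₁ e₂ with h x (there (here refl) p) (there (here refl) q) e₁ e₂
    ... | refl = refl
    tail : UniqueLeafPositions (node ts)
    tail x here         here         _  _  = refl
    tail x here         (there m q)  () _
    tail x (there m p)  here         _  ()
    tail x (there m p)  (there m′ q) e₁ e₂ with h x (there (there m) p) (there (there m′) q) e₁ e₂
    ... | refl = refl
    disjoint : ∀ {v} → ¬ (v ∈ leaves t × v ∈ forestLeaves ts)
    disjoint {v} (v∈t , v∈ts) with ∈L⇒leafPos (∈leaves⇒∈L t v∈t) | ∈-forestLeaves⁻ v∈ts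
    ... | p , e | c , m , v∈c with ∈L⇒leafPos v∈c
    ...   | q , e′ with h v (there (here refl) p) (there (there m) q) e e′
    ...     | ()

  TwoChildren : Tree n → Set
  TwoChildren t = (p : Pos t) (ts : List (Tree n)) → subtree p ≡ node ts → 2 ≤ length ts

  data Branching : Tree n → Set where
    leafᵇ : {x : Fin n} → Branching (leaf x)
    nodeᵇ : {ts : List (Tree n)} → 2 ≤ length ts → (∀ {c} → c ∈ ts → Branching c) →
            Branching (node ts)

  Branching⇒twoChildren : {t : Tree n} → Branching t → TwoChildren t
  Branching⇒twoChildren (nodeᵇ l _)  here        ts refl = l
  Branching⇒twoChildren (nodeᵇ _ bs) (there m p) ts e    = Branching⇒twoChildren (bs m) p ts e

  twoChildren⇒Branching : (t : Tree n) → TwoChildren t → Branching t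
  twoChildren⇒Branching (leaf x)  h = leafᵇ
  twoChildren⇒Branching (node ts) h = nodeᵇ (h here ts refl) (children ts (λ m p → h (there m p)))
    where
    children : (us : List (Tree n)) → (∀ {c} → c ∈ us → TwoChildren c) → ∀ {c} → c ∈ us → Branching c
    children (u ∷ us) h (here refl) = twoChildren⇒Branching u (h (here refl))
    children (u ∷ us) h (there m)   = children us (λ m′ → h (there m′)) m

  _⊆L_ : Tree n → Tree n → Set
  s ⊆L s′ = ∀ {v} → v ∈L s → v ∈L s′

  there-injective : {ts : List (Tree n)} {c₁ c₂ : Tree n} {m₁ : c₁ ∈ ts} {m₂ : c₂ ∈ ts}
                    {a : Pos c₁} {b : Pos c₂} → there {ts = ts} m₁ a ≡ there m₂ b →
                    Σ (c₁ ≡ c₂) λ e → (subst (_∈ ts) e m₁ ≡ m₂) × (subst Pos e a ≡ b)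
  there-injective refl = refl , refl , refl

  extend-meet⇒nested : {t : Tree n} (q₁ q₂ : Pos t) (r₁ : Pos (subtree q₁)) (r₂ : Pos (subtree q₂)) →
                       extend q₁ r₁ ≡ extend q₂ r₂ →
                       subtree q₁ ⊆L subtree q₂ ⊎ subtree q₂ ⊆L subtree q₁
  extend-meet⇒nested here          q₂            _  _  _ = inj₂ (∈L-subtree⇒∈L q₂)
  extend-meet⇒nested (there m p)   here          _  _  _ = inj₁ (∈L-subtree⇒∈L (there m p))
  extend-meet⇒nested (there m₁ p₁) (there m₂ p₂) r₁ r₂ eq with there-injective eq
  ... | refl , refl , eq′ = extend-meet⇒nested p₁ p₂ r₁ r₂ eq′

  laminar : {t : Tree n} → UniqueLeafPositions t → (q₁ q₂ : Pos t) {w : Fin n} →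
            w ∈L subtree q₁ → w ∈L subtree q₂ → subtree q₁ ⊆L subtree q₂ ⊎ subtree q₂ ⊆L subtree q₁
  laminar unique q₁ q₂ {w} w∈q₁ w∈q₂ with ∈L⇒leafPos w∈q₁ | ∈L⇒leafPos w∈q₂
  ... | r₁ , e₁ | r₂ , e₂ = extend-meet⇒nested q₁ q₂ r₁ r₂
        (unique w (extend q₁ r₁) (extend q₂ r₂)
                  (trans (subtree-extend q₁ r₁) e₁) (trans (subtree-extend q₂ r₂) e₂))

  Phylo⇒∈L : {t : Tree n} → Phylo t → (x : Fin n) → x ∈L t
  Phylo⇒∈L ph x = leafPos⇒∈L (proj₁ (Phylo.leafSet ph x)) (proj₂ (Phylo.leafSet ph x))

  SameLeaves : Tree n → Tree n → Set
  SameLeaves s s′ = (x : Fin n) → x ∈L s ⇔ x ∈L s′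

  SameLeaves-sym : {s s′ : Tree n} → SameLeaves s s′ → SameLeaves s′ s
  SameLeaves-sym h x = ⇔-sym (h x)

  leaves↭⇒SameLeaves : {s s′ : Tree n} → leaves s ↭ leaves s′ → SameLeaves s s′
  leaves↭⇒SameLeaves p x = mk⇔ (∈L-resp-leaves↭ p) (∈L-resp-leaves↭ (↭-sym p))

module Blocks {n : ℕ} (P : Fin n → ℕ) where

  Crosses : Tree n → ℕ → Set
  Crosses s A = Σ (Fin n) λ y → Σ (Fin n) λ z → y ∈L s × ¬ z ∈L s × P y ≡ A × P z ≡ A

  crosses? : (s : Tree n) (A : ℕ) → Dec (Crosses s A)
  crosses? s A = Fin.any? λ y → Fin.any? λ z →
    (y ∈L? s) ×-dec ¬? (z ∈L? s) ×-dec (P y ≟ A) ×-dec (P z ≟ A)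

  Crossed : Tree n → Set
  Crossed s = Σ (Fin n) λ y → Σ (Fin n) λ z → y ∈L s × ¬ z ∈L s × P y ≡ P z

  crossed? : (s : Tree n) → Dec (Crossed s)
  crossed? s = Fin.any? λ y → Fin.any? λ z → (y ∈L? s) ×-dec ¬? (z ∈L? s) ×-dec (P y ≟ P z)

  AtMostOneCrossing : Tree n → Set
  AtMostOneCrossing s = ∀ {A B} → Crosses s A → Crosses s B → A ≡ B

  CrossingsAgree : List (Tree n) → Set
  CrossingsAgree ts = ∀ {c₁ c₂} → c₁ ∈ ts → c₂ ∈ ts →
                      ∀ {A₁ A₂} → Crosses c₁ A₁ → Crosses c₂ A₂ → A₁ ≡ A₂

  AtMostOneCrossingBelow : Tree n → Set
  AtMostOneCrossingBelow s = (p : Pos s) → AtMostOneCrossing (subtree p)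

  data Resolved : Tree n → Set where
    leafʳ : {x : Fin n} → Resolved (leaf x)
    nodeʳ : {ts : List (Tree n)} → CrossingsAgree ts → (∀ {c} → c ∈ ts → Resolved c) →
            Resolved (node ts)

  Crosses-resp-SameLeaves : {s s′ : Tree n} {A : ℕ} → SameLeaves s s′ → Crosses s A → Crosses s′ A
  Crosses-resp-SameLeaves h (y , z , y∈s , z∉s , Py , Pz) =
    y , z , Equivalence.to (h y) y∈s , (λ z∈s′ → z∉s (Equivalence.from (h z) z∈s′)) , Py , Pz

  AtMostOneCrossing-resp-SameLeaves : {s s′ : Tree n} → SameLeaves s s′ →
                                      AtMostOneCrossing s → AtMostOneCrossing s′
  AtMostOneCrossing-resp-SameLeaves h one cA cB =
    one (Crosses-resp-SameLeaves (SameLeaves-sym h) cA) (Crosses-resp-SameLeaves (SameLeaves-sym h) cB)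

  crossedBy : ℕ → List (Tree n) → List (Tree n)
  crossedBy B = filter (λ i → crosses? i B)

  notCrossedBy : ℕ → List (Tree n) → List (Tree n)
  notCrossedBy B = filter (λ i → ¬? (crosses? i B))

  ∈-crossedBy⁺ : ∀ {B I i} → i ∈ I → Crosses i B → i ∈ crossedBy B I
  ∈-crossedBy⁺ {B} = ∈-filter⁺ (λ j → crosses? j B)

  ∈-crossedBy⁻ : ∀ {B I i} → i ∈ crossedBy B I → i ∈ I × Crosses i B
  ∈-crossedBy⁻ {B} {I} = ∈-filter⁻ (λ j → crosses? j B) {xs = I}

  ∈-notCrossedBy⁺ : ∀ {B I i} → i ∈ I → ¬ Crosses i B → i ∈ notCrossedBy B I
  ∈-notCrossedBy⁺ {B} = ∈-filter⁺ (λ j → ¬? (crosses? j B))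

  ∈-notCrossedBy⁻ : ∀ {B I i} → i ∈ notCrossedBy B I → i ∈ I × ¬ Crosses i B
  ∈-notCrossedBy⁻ {B} {I} = ∈-filter⁻ (λ j → ¬? (crosses? j B)) {xs = I}

  Groupable : Tree n → ℕ → List (Tree n) → Set
  Groupable u B I = ¬ Crosses u B × 2 ≤ length (crossedBy B I) × 1 ≤ length (notCrossedBy B I)

  groupable? : (u : Tree n) (B : ℕ) (I : List (Tree n)) → Dec (Groupable u B I)
  groupable? u B I =
    ¬? (crosses? u B) ×-dec (2 ≤? length (crossedBy B I)) ×-dec (1 ≤? length (notCrossedBy B I))

  -- The side conditions keep every vertex at least binary.
  group : Tree n → ℕ → List (Tree n) → List (Tree n)
  group u B I with groupable? u B I
  ... | yes _ = node (crossedBy B I) ∷ notCrossedBy B I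
  ... | no _  = I

  groupAll : Tree n → List ℕ → List (Tree n) → List (Tree n)
  groupAll u Bs I = foldl (λ J B → group u B J) I Bs

  blockLabels : List ℕ
  blockLabels = map P (allFin n)

  crossing∈blockLabels : ∀ {s A} → Crosses s A → A ∈ blockLabels
  crossing∈blockLabels (y , _ , _ , _ , Py , _) = subst (_∈ blockLabels) Py (∈-map⁺ P (∈-allFin y))

  refine       : Tree n → Tree n
  refineForest : List (Tree n) → List (Tree n)
  refine (leaf x)  = leaf x
  refine (node ts) = node (groupAll (node (refineForest ts)) blockLabels (refineForest ts))
  refineForest []       = []
  refineForest (t ∷ ts) = refine t ∷ refineForest ts

  crossedBy++notCrossedBy↭ : (B : ℕ) (I : List (Tree n)) →
                             forestLeaves (crossedBy B I) ++ forestLeaves (notCrossedBy B I) ↭ forestLeaves I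
  crossedBy++notCrossedBy↭ B []      = ↭-refl
  crossedBy++notCrossedBy↭ B (i ∷ I) = split (crosses? i B)
    where
    crossed uncrossed : List (Fin n)
    crossed   = forestLeaves (crossedBy B I)
    uncrossed = forestLeaves (notCrossedBy B I)
    split : Dec (Crosses i B) →
            forestLeaves (crossedBy B (i ∷ I)) ++ forestLeaves (notCrossedBy B (i ∷ I)) ↭ forestLeaves (i ∷ I)
    split (yes c) rewrite filter-accept (λ j → crosses? j B) {i} {I} c
                        | filter-reject (λ j → ¬? (crosses? j B)) {i} {I} (λ ¬c → ¬c c) =
      ↭-trans (↭-reflexive (++-assoc (leaves i) crossed uncrossed))
              (++⁺ˡ (leaves i) (crossedBy++notCrossedBy↭ B I))
    split (no ¬c) rewrite filter-reject (λ j → crosses? j B) {i} {I} ¬c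
                        | filter-accept (λ j → ¬? (crosses? j B)) {i} {I} ¬c =
      ↭-trans (shifts crossed (leaves i)) (++⁺ˡ (leaves i) (crossedBy++notCrossedBy↭ B I))

  group-leaves↭ : (u : Tree n) (B : ℕ) (I : List (Tree n)) → forestLeaves (group u B I) ↭ forestLeaves I
  group-leaves↭ u B I with groupable? u B I
  ... | yes _ = crossedBy++notCrossedBy↭ B I
  ... | no _  = ↭-refl

  groupAll-leaves↭ : (u : Tree n) (Bs : List ℕ) (I : List (Tree n)) →
                     forestLeaves (groupAll u Bs I) ↭ forestLeaves I
  groupAll-leaves↭ u []       I = ↭-refl
  groupAll-leaves↭ u (B ∷ Bs) I = ↭-trans (groupAll-leaves↭ u Bs (group u B I)) (group-leaves↭ u B I)

  refine-leaves↭       : (s : Tree n) → leaves (refine s) ↭ leaves s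
  refineForest-leaves↭ : (ts : List (Tree n)) → forestLeaves (refineForest ts) ↭ forestLeaves ts
  refine-leaves↭ (leaf x)  = ↭-refl
  refine-leaves↭ (node ts) =
    ↭-trans (groupAll-leaves↭ _ blockLabels (refineForest ts)) (refineForest-leaves↭ ts)
  refineForest-leaves↭ []       = ↭-refl
  refineForest-leaves↭ (t ∷ ts) = ++⁺ (refine-leaves↭ t) (refineForest-leaves↭ ts)

  group-HasSubtree : (u : Tree n) (B : ℕ) (I : List (Tree n)) {r : Tree n} →
                     HasSubtree I r → HasSubtree (group u B I) r
  group-HasSubtree u B I h with groupable? u B I
  group-HasSubtree u B I (c , m , q , e) | yes _ with crosses? c B
  ... | yes c∼B = node (crossedBy B I) , here refl , there (∈-crossedBy⁺ m c∼B) q , e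
  ... | no c≁B  = c , there (∈-notCrossedBy⁺ m c≁B) , q , e
  group-HasSubtree u B I h | no _ = h

  groupAll-HasSubtree : (u : Tree n) (Bs : List ℕ) (I : List (Tree n)) {r : Tree n} →
                        HasSubtree I r → HasSubtree (groupAll u Bs I) r
  groupAll-HasSubtree u []       I h = h
  groupAll-HasSubtree u (B ∷ Bs) I h = groupAll-HasSubtree u Bs (group u B I) (group-HasSubtree u B I h)

  refine-∈ : {c : Tree n} {ts : List (Tree n)} → c ∈ ts → refine c ∈ refineForest ts
  refine-∈ (here refl) = here refl
  refine-∈ (there m)   = there (refine-∈ m)

  refine-pos : (s : Tree n) (p : Pos s) → Σ (Pos (refine s)) λ q → subtree q ≡ refine (subtree p)
  refine-pos s         here                  = here , refl
  refine-pos (node ts) (there {c = c} m p)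
    with groupAll-HasSubtree (node (refineForest ts)) blockLabels (refineForest ts)
                             (refine c , refine-∈ m , here , refl)
       | refine-pos c p
  ... | c′ , m′ , q₀ , e₀ | q , e with extend-along q₀ e₀ q
  ...   | q′ , e′ = there m′ q′ , trans e′ e

  AllBranching : List (Tree n) → Set
  AllBranching I = ∀ {i} → i ∈ I → Branching i

  group-branching : (u : Tree n) (B : ℕ) (I : List (Tree n)) → 2 ≤ length I → AllBranching I →
                    2 ≤ length (group u B I) × AllBranching (group u B I)
  group-branching u B I l bs with groupable? u B I
  ... | no _              = l , bs
  ... | yes (_ , l₂ , l₁) = s≤s l₁ , branching
    where
    branching : AllBranching (node (crossedBy B I) ∷ notCrossedBy B I)
    branching (here refl) = nodeᵇ l₂ (λ m → bs (proj₁ (∈-crossedBy⁻ m)))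
    branching (there m)   = bs (proj₁ (∈-notCrossedBy⁻ m))

  groupAll-branching : (u : Tree n) (Bs : List ℕ) (I : List (Tree n)) → 2 ≤ length I → AllBranching I →
                       2 ≤ length (groupAll u Bs I) × AllBranching (groupAll u Bs I)
  groupAll-branching u []       I l bs = l , bs
  groupAll-branching u (B ∷ Bs) I l bs with group-branching u B I l bs
  ... | l′ , bs′ = groupAll-branching u Bs (group u B I) l′ bs′

  length-refineForest : (ts : List (Tree n)) → length (refineForest ts) ≡ length ts
  length-refineForest []       = refl
  length-refineForest (t ∷ ts) = cong suc (length-refineForest ts)

  refine-branching       : (s : Tree n) → Branching s → Branching (refine s)
  refineForest-branching : (ts : List (Tree n)) → AllBranching ts → AllBranching (refineForest ts)
  refine-branching (leaf x)  _ = leafᵇ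
  refine-branching (node ts) (nodeᵇ l bs)
    with groupAll-branching (node (refineForest ts)) blockLabels (refineForest ts)
           (subst (2 ≤_) (sym (length-refineForest ts)) l) (refineForest-branching ts bs)
  ... | l′ , bs′ = nodeᵇ l′ bs′
  refineForest-branching (t ∷ ts) bs (here refl) = refine-branching t (bs (here refl))
  refineForest-branching (t ∷ ts) bs (there m)   = refineForest-branching ts (λ m′ → bs (there m′)) m

  AllResolved : List (Tree n) → Set
  AllResolved I = ∀ {i} → i ∈ I → Resolved i × AtMostOneCrossing i

  module Regrouping (R : List (Tree n)) (uniqueR : Unique (forestLeaves R)) where

    u : Tree n
    u = node R

    Invariant : List (Tree n) → Set
    Invariant I = (forestLeaves I ↭ forestLeaves R) × AllResolved I

    Saturated : List (Tree n) → ℕ → Set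
    Saturated I A = ¬ Crosses u A → (Σ (Tree n) λ i → i ∈ I × Crosses i A) →
                    ∀ {j} → j ∈ I → Crosses j A

    module _ {I : List (Tree n)} (inv : Invariant I) where

      uniqueI : Unique (forestLeaves I)
      uniqueI = Unique-resp-↭ (↭-sym (proj₁ inv)) uniqueR

      resolved : AllResolved I
      resolved = proj₂ inv

      crossedOnce : ∀ {i} → i ∈ I → AtMostOneCrossing i
      crossedOnce i∈I = proj₂ (resolved i∈I)

      item⊆u : ∀ {y d} → d ∈ I → y ∈L d → y ∈L u
      item⊆u d∈I y∈d =
        ∈leaves⇒∈L u (∈-resp-↭ (proj₁ inv) (∈-forestLeaves⁺ d∈I (∈L⇒∈leaves y∈d)))

      u⊆items : ∀ {y} → y ∈L u → Σ (Tree n) λ d → d ∈ I × y ∈L d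
      u⊆items y∈u = ∈-forestLeaves⁻ (∈-resp-↭ (↭-sym (proj₁ inv)) (∈L⇒∈leaves y∈u))

      apart : ∀ {y z c d} → c ∈ I → d ∈ I → y ∈L c → z ∈L d → ¬ z ∈L c → ¬ y ∈L d
      apart c∈I d∈I y∈c z∈d z∉c y∈d with Unique-sharedLeaf⇒≡ uniqueI c∈I d∈I y∈c y∈d
      ... | refl = z∉c z∈d

      exitItem : ∀ {B c y z} → ¬ Crosses u B → c ∈ I → y ∈L c → ¬ z ∈L c → P y ≡ B → P z ≡ B →
             Σ (Tree n) λ d → d ∈ I × z ∈L d × Crosses d B
      exitItem u≁B c∈I y∈c z∉c Py Pz with _ ∈L? u
      ... | no z∉u  = ⊥-elim (u≁B (_ , _ , item⊆u c∈I y∈c , z∉u , Py , Pz))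
      ... | yes z∈u with u⊆items z∈u
      ...   | d , d∈I , z∈d = d , d∈I , z∈d , (_ , _ , z∈d , apart c∈I d∈I y∈c z∈d z∉c , Pz , Py)

      crossed-elsewhere : ∀ {B c} → ¬ Crosses u B → c ∈ I → Crosses c B →
                          Σ (Tree n) λ d → d ∈ I × Crosses d B × d ≢ c
      crossed-elsewhere u≁B c∈I (y , z , y∈c , z∉c , Py , Pz) with exitItem u≁B c∈I y∈c z∉c Py Pz
      ... | d , d∈I , z∈d , d∼B = d , d∈I , d∼B , λ { refl → z∉c z∈d }

      -- A is also a crossing of the grouped item c ∋ y, hence A = B; but then the item
      -- containing z is crossed by B as well, so it was grouped too.
      grouped-uncrossed : ∀ {A B} → ¬ Crosses u B → ¬ Crosses (node (crossedBy B I)) A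
      grouped-uncrossed {A} {B} u≁B (y , z , inNode m y∈c , z∉g , Py , Pz)
        with ∈-crossedBy⁻ m
      ... | c∈I , c∼B with crossedOnce c∈I (y , z , y∈c , (λ z∈c → z∉g (inNode m z∈c)) , Py , Pz) c∼B
      ...   | refl with exitItem u≁B c∈I y∈c (λ z∈c → z∉g (inNode m z∈c)) Py Pz
      ...     | d , d∈I , z∈d , d∼B = z∉g (inNode (∈-crossedBy⁺ d∈I d∼B) z∈d)

    group-invariant : (B : ℕ) {I : List (Tree n)} → Invariant I → Invariant (group u B I)
    group-invariant B {I} inv with groupable? u B I
    ... | no _              = inv
    ... | yes (u≁B , _ , _) = ↭-trans (crossedBy++notCrossedBy↭ B I) (proj₁ inv) , items
      where
      items : AllResolved (node (crossedBy B I) ∷ notCrossedBy B I)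
      items (here refl) = nodeʳ agree (λ m → proj₁ (resolved inv (proj₁ (∈-crossedBy⁻ m))))
                        , (λ c _ → ⊥-elim (grouped-uncrossed inv u≁B c))
        where
        agree : CrossingsAgree (crossedBy B I)
        agree m₁ m₂ c₁ c₂ with ∈-crossedBy⁻ m₁ | ∈-crossedBy⁻ m₂
        ... | i₁ , b₁ | i₂ , b₂ = trans (crossedOnce inv i₁ c₁ b₁) (sym (crossedOnce inv i₂ c₂ b₂))
      items (there m) = resolved inv (proj₁ (∈-notCrossedBy⁻ m))

    -- If B could not be grouped, it is because B already crosses every item (or none).
    group-saturates : (B : ℕ) {I : List (Tree n)} → Invariant I → Saturated (group u B I) B
    group-saturates B {I} inv with groupable? u B I
    ... | yes (u≁B , _) = λ _ → λ
      { (j , here refl , j∼B) → ⊥-elim (grouped-uncrossed inv u≁B j∼B)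
      ; (j , there m , j∼B)   → ⊥-elim (proj₂ (∈-notCrossedBy⁻ {B} {I} m) j∼B) }
    ... | no ¬groupable = λ u≁B (i , i∈I , i∼B) {j} j∈I → saturate u≁B i∈I i∼B j∈I
      where
      saturate : ∀ {i j} → ¬ Crosses u B → i ∈ I → Crosses i B → j ∈ I → Crosses j B
      saturate {j = j} u≁B i∈I i∼B j∈I with crosses? j B
      ... | yes j∼B = j∼B
      ... | no j≁B with crossed-elsewhere inv u≁B i∈I i∼B
      ...   | d , d∈I , d∼B , d≢i = ⊥-elim (¬groupable
              ( u≁B
              , ∈-distinct⇒2≤length (∈-crossedBy⁺ d∈I d∼B) (∈-crossedBy⁺ i∈I i∼B) d≢i
              , ∈-length (∈-notCrossedBy⁺ j∈I j≁B) ))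

    group-preserves-saturated : (B A : ℕ) {I : List (Tree n)} → Invariant I →
                                Saturated I A → Saturated (group u B I) A
    group-preserves-saturated B A {I} inv sat with groupable? u B I
    ... | no _ = sat
    ... | yes (u≁B , 2≤ , _) = λ u≁A → λ
      { (j , here refl , j∼A) → ⊥-elim (grouped-uncrossed inv u≁B j∼A)
      ; (j , there m , j∼A)   → ⊥-elim (rest-uncrossed u≁A m j∼A) }
      where
      -- Saturation makes A cross a grouped item, which only B crosses; so A = B, yet j ∉ crossedBy B.
      rest-uncrossed : ¬ Crosses u A → ∀ {j} → j ∈ notCrossedBy B I → ¬ Crosses j A
      rest-uncrossed u≁A m j∼A with ∈-notCrossedBy⁻ m | nonempty⇒∃∈ (<⇒≤ 2≤)
      ... | j∈I , j≁B | c , c∈g with ∈-crossedBy⁻ c∈g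
      ...   | c∈I , c∼B with crossedOnce inv c∈I (sat u≁A (_ , j∈I , j∼A) c∈I) c∼B
      ...     | refl = j≁B j∼A

    groupAll-invariant : (Bs : List ℕ) {I : List (Tree n)} → Invariant I → Invariant (groupAll u Bs I)
    groupAll-invariant []       inv = inv
    groupAll-invariant (B ∷ Bs) inv = groupAll-invariant Bs (group-invariant B inv)

    groupAll-preserves-saturated : (Bs : List ℕ) (A : ℕ) {I : List (Tree n)} → Invariant I →
                                   Saturated I A → Saturated (groupAll u Bs I) A
    groupAll-preserves-saturated []       A inv sat = sat
    groupAll-preserves-saturated (B ∷ Bs) A inv sat =
      groupAll-preserves-saturated Bs A (group-invariant B inv) (group-preserves-saturated B A inv sat)

    groupAll-saturates : (Bs : List ℕ) {I : List (Tree n)} → Invariant I →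
                         ∀ {A} → A ∈ Bs → Saturated (groupAll u Bs I) A
    groupAll-saturates (B ∷ Bs) inv (here refl) =
      groupAll-preserves-saturated Bs B (group-invariant B inv) (group-saturates B inv)
    groupAll-saturates (B ∷ Bs) inv (there m)   = groupAll-saturates Bs (group-invariant B inv) m

    saturated⇒crossingsAgree : AtMostOneCrossing u → {J : List (Tree n)} → Invariant J →
                               (∀ {A} → A ∈ blockLabels → Saturated J A) → CrossingsAgree J
    saturated⇒crossingsAgree one inv sat {c₁} {c₂} m₁ m₂ {A₁} {A₂} c₁∼A₁ c₂∼A₂
      with crosses? u A₁ | crosses? u A₂
    ... | yes u∼A₁ | yes u∼A₂ = one u∼A₁ u∼A₂
    ... | no u≁A₁  | _        =
      crossedOnce inv m₂ (sat (crossing∈blockLabels c₁∼A₁) u≁A₁ (c₁ , m₁ , c₁∼A₁) m₂) c₂∼A₂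
    ... | _        | no u≁A₂  =
      crossedOnce inv m₁ c₁∼A₁ (sat (crossing∈blockLabels c₂∼A₂) u≁A₂ (c₂ , m₂ , c₂∼A₂) m₁)

  refine-resolved : (s : Tree n) → AtMostOneCrossingBelow s → Unique (leaves s) → Resolved (refine s)
  refineForest-resolved : (ts : List (Tree n)) →
                          (∀ {c} → c ∈ ts → AtMostOneCrossingBelow c × Unique (leaves c)) →
                          AllResolved (refineForest ts)
  refine-resolved (leaf x)  _   _      = leafʳ
  refine-resolved (node ts) one unique =
    nodeʳ (R.saturated⇒crossingsAgree oneR final (R.groupAll-saturates blockLabels start))
          (λ m → proj₁ (proj₂ final m))
    where
    uniqueR : Unique (forestLeaves (refineForest ts))
    uniqueR = Unique-resp-↭ (↭-sym (refineForest-leaves↭ ts)) unique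
    module R = Regrouping (refineForest ts) uniqueR
    start : R.Invariant (refineForest ts)
    start = ↭-refl , refineForest-resolved ts (λ m → (λ p → one (there m p)) , Unique-child unique m)
    final : R.Invariant (groupAll R.u blockLabels (refineForest ts))
    final = R.groupAll-invariant blockLabels start
    oneR : AtMostOneCrossing R.u
    oneR = AtMostOneCrossing-resp-SameLeaves
             (leaves↭⇒SameLeaves (↭-sym (refineForest-leaves↭ ts))) (one here)
  refineForest-resolved (t ∷ ts) h (here refl) with h (here refl)
  ... | one , unique =
    refine-resolved t one unique ,
    AtMostOneCrossing-resp-SameLeaves (leaves↭⇒SameLeaves (↭-sym (refine-leaves↭ t))) (one here)
  refineForest-resolved (t ∷ ts) h (there m) = refineForest-resolved ts (λ m′ → h (there m′)) m

  UncrossedAround : Tree n → Fin n → Set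
  UncrossedAround s x = Σ (Pos s) λ r → ¬ Crossed (subtree r) × x ∈L subtree r

  uncrossedAround⊎crosses : {x : Fin n} {s : Tree n} → Resolved s → x ∈L s →
                            UncrossedAround s x ⊎ Crosses s (P x)
  uncrossedAround⊎crosses {x} leafʳ inLeaf with crossed? (leaf x)
  ... | no ¬crossed                       = inj₁ (here , ¬crossed , inLeaf)
  ... | yes (_ , z , inLeaf , z∉ , Px≡Pz) = inj₂ (x , z , inLeaf , z∉ , refl , sym Px≡Pz)
  uncrossedAround⊎crosses {x} {node ts} (nodeʳ agree rs) (inNode m x∈c)
    with uncrossedAround⊎crosses (rs m) x∈c
  ... | inj₁ (r , ¬crossed , x∈r) = inj₁ (there m r , ¬crossed , x∈r)
  ... | inj₂ c∼Px with crossed? (node ts)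
  ...   | no ¬crossed = inj₁ (here , ¬crossed , inNode m x∈c)
  ...   | yes (y , z , inNode m′ y∈c′ , z∉ , Py≡Pz)
          with agree m m′ c∼Px (y , z , y∈c′ , (λ z∈c′ → z∉ (inNode m′ z∈c′)) , refl , sym Py≡Pz)
  ...     | Px≡Py = inj₂ (y , z , inNode m′ y∈c′ , z∉ , sym Px≡Py , trans (sym Py≡Pz) (sym Px≡Py))

  -- Below the lowest vertex containing x and x′, the children c₁ ∋ x and c₂ ∋ x′ are crossed by
  -- different blocks or not at all, so one of them has an uncrossed cluster around its leaf.
  separatingUncrossedEdge : {x x′ : Fin n} {s : Tree n} → Resolved s → Unique (leaves s) →
                            x ∈L s → x′ ∈L s → P x ≢ P x′ →
                            Σ (Edge s) λ e → ¬ Crossed (subtree (proj₁ e)) × OnPath e x x′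
  separatingUncrossedEdge leafʳ _ inLeaf inLeaf Px≢Px′ = ⊥-elim (Px≢Px′ refl)
  separatingUncrossedEdge {x} {x′} (nodeʳ agree rs) unique
                          (inNode {c = c₁} m₁ x∈c₁) (inNode {c = c₂} m₂ x′∈c₂) Px≢Px′
    with x′ ∈L? c₁ | x ∈L? c₂
  ... | yes x′∈c₁ | _
        with separatingUncrossedEdge (rs m₁) (Unique-child unique m₁) x∈c₁ x′∈c₁ Px≢Px′
  ...     | (r , _) , ¬crossed , sep = (there m₁ r , isThere m₁ r) , ¬crossed , sep
  separatingUncrossedEdge _ unique (inNode m₁ x∈c₁) (inNode m₂ x′∈c₂) _ | no x′∉c₁ | yes x∈c₂
        with Unique-sharedLeaf⇒≡ unique m₁ m₂ x∈c₁ x∈c₂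
  ...     | refl = ⊥-elim (x′∉c₁ x′∈c₂)
  separatingUncrossedEdge (nodeʳ agree rs) _ (inNode m₁ x∈c₁) (inNode m₂ x′∈c₂) Px≢Px′ | no x′∉c₁ | no x∉c₂
        with uncrossedAround⊎crosses (rs m₁) x∈c₁ | uncrossedAround⊎crosses (rs m₂) x′∈c₂
  ... | inj₁ (r , ¬crossed , x∈r) | _ =
    (there m₁ r , isThere m₁ r) , ¬crossed , inj₁ (x∈r , λ x′∈r → x′∉c₁ (∈L-subtree⇒∈L r x′∈r))
  ... | inj₂ _ | inj₁ (r , ¬crossed , x′∈r) =
    (there m₂ r , isThere m₂ r) , ¬crossed , inj₂ ((λ x∈r → x∉c₂ (∈L-subtree⇒∈L r x∈r)) , x′∈r)
  ... | inj₂ c₁∼Px | inj₂ c₂∼Px′ = ⊥-elim (Px≢Px′ (agree m₁ m₂ c₁∼Px c₂∼Px′))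

  uncrossedEdge : {t : Tree n} → Edge t → Bool
  uncrossedEdge (p , _) = isNo (crossed? (subtree p))

  uncrossedEdge⇒¬Crossed : {t : Tree n} (e : Edge t) → uncrossedEdge e ≡ true →
                           ¬ Crossed (subtree (proj₁ e))
  uncrossedEdge⇒¬Crossed (p , _) _ with crossed? (subtree p)
  ... | no ¬crossed = ¬crossed

  ¬Crossed⇒uncrossedEdge : {t : Tree n} (e : Edge t) → ¬ Crossed (subtree (proj₁ e)) →
                           uncrossedEdge e ≡ true
  ¬Crossed⇒uncrossedEdge (p , _) ¬crossed with crossed? (subtree p)
  ... | yes crossed = ⊥-elim (¬crossed crossed)
  ... | no _        = refl

  resolved⇒compatible : (t : Tree n) → Resolved t → Unique (leaves t) → (∀ x → x ∈L t) → Compatible t P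
  resolved⇒compatible t resolved unique all∈t =
    uncrossedEdge , λ x x′ → mk⇔ (same⇒connected x x′) (connected⇒same x x′)
    where
    same⇒connected : ∀ x x′ → SameBlock P x x′ → SameComponent t uncrossedEdge x x′
    same⇒connected x x′ Px≡Px′ e cut (inj₁ (x∈ , x′∉)) =
      uncrossedEdge⇒¬Crossed e cut (x , x′ , x∈ , x′∉ , Px≡Px′)
    same⇒connected x x′ Px≡Px′ e cut (inj₂ (x∉ , x′∈)) =
      uncrossedEdge⇒¬Crossed e cut (x′ , x , x′∈ , x∉ , sym Px≡Px′)
    connected⇒same : ∀ x x′ → SameComponent t uncrossedEdge x x′ → SameBlock P x x′
    connected⇒same x x′ connected with P x ≟ P x′
    ... | yes Px≡Px′ = Px≡Px′
    ... | no Px≢Px′ with separatingUncrossedEdge resolved unique (all∈t x) (all∈t x′) Px≢Px′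
    ...   | e , ¬crossed , sep = ⊥-elim (connected e (¬Crossed⇒uncrossedEdge e ¬crossed) sep)

  -- Two blocks crossing the same cluster q are joined through q's inside: an edge cutting
  -- one inside element from the other is nested with q by laminarity, and so either lies
  -- inside q and cuts a block from its own outside element, or contains q entirely.
  compatible⇒atMostOneCrossing : (t : Tree n) → UniqueLeafPositions t → Compatible t P →
                                 AtMostOneCrossingBelow t
  compatible⇒atMostOneCrossing t unique (H , blocks) q
    (a , a′ , a∈q , a′∉q , Pa , Pa′) (b , b′ , b∈q , b′∉q , Pb , Pb′) =
    trans (sym Pa) (trans (Equivalence.from (blocks a b) a~b) Pb)
    where
    connected : ∀ x x′ → P x ≡ P x′ → SameComponent t H x x′
    connected x x′ = Equivalence.to (blocks x x′)
    a~b : SameComponent t H a b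
    a~b (q′ , nr) cut (inj₁ (a∈q′ , b∉q′)) with a′ ∈L? subtree q′
    ... | no a′∉q′ = connected a a′ (trans Pa (sym Pa′)) (q′ , nr) cut (inj₁ (a∈q′ , a′∉q′))
    ... | yes a′∈q′ with laminar unique q′ q a∈q′ a∈q
    ...   | inj₁ q′⊆q = a′∉q (q′⊆q a′∈q′)
    ...   | inj₂ q⊆q′ = b∉q′ (q⊆q′ b∈q)
    a~b (q′ , nr) cut (inj₂ (a∉q′ , b∈q′)) with b′ ∈L? subtree q′
    ... | no b′∉q′ = connected b b′ (trans Pb (sym Pb′)) (q′ , nr) cut (inj₁ (b∈q′ , b′∉q′))
    ... | yes b′∈q′ with laminar unique q′ q b∈q′ b∈q
    ...   | inj₁ q′⊆q = b′∉q (q′⊆q b′∈q′)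
    ...   | inj₂ q⊆q′ = a∉q′ (q⊆q′ a∈q)

  inColor⇒crosses : {t : Tree n} (e : Edge t) {x : Fin n} → InColor P e x →
                    Crosses (subtree (proj₁ e)) (P x)
  inColor⇒crosses e (x₁ , x₂ , Px≡Px₁ , Px≡Px₂ , inj₁ (x₁∈ , x₂∉)) =
    x₁ , x₂ , x₁∈ , x₂∉ , sym Px≡Px₁ , sym Px≡Px₂
  inColor⇒crosses e (x₁ , x₂ , Px≡Px₁ , Px≡Px₂ , inj₂ (x₁∉ , x₂∈)) =
    x₂ , x₁ , x₂∈ , x₁∉ , sym Px≡Px₂ , sym Px≡Px₁

  crosses⇒inColor : {t : Tree n} (e : Edge t) {A : ℕ} (c : Crosses (subtree (proj₁ e)) A) →
                    InColor P e (proj₁ c)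
  crosses⇒inColor e (y , z , y∈ , z∉ , Py , Pz) = y , z , refl , trans Py (sym Pz) , inj₁ (y∈ , z∉)

  atMostOneCrossing⇒colorAtMostOne : {t : Tree n} (e : Edge t) →
                                     AtMostOneCrossing (subtree (proj₁ e)) → ColorAtMostOne P e
  atMostOneCrossing⇒colorAtMostOne e one x y x∈γ y∈γ = one (inColor⇒crosses e x∈γ) (inColor⇒crosses e y∈γ)

  colorAtMostOne⇒atMostOneCrossing : {t : Tree n} (e : Edge t) →
                                     ColorAtMostOne P e → AtMostOneCrossing (subtree (proj₁ e))
  colorAtMostOne⇒atMostOneCrossing e γ≤1 cA@(_ , _ , _ , _ , PyA , _) cB@(_ , _ , _ , _ , PyB , _) =
    trans (sym PyA) (trans (γ≤1 _ _ (crosses⇒inColor e cA) (crosses⇒inColor e cB)) PyB)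

  Phylo⇒uncrossed : {t : Tree n} → Phylo t → ∀ {A} → ¬ Crosses t A
  Phylo⇒uncrossed ph (_ , z , _ , z∉t , _) = z∉t (Phylo⇒∈L ph z)

  colorAtMostOne⇒atMostOneCrossingBelow : {t : Tree n} → Phylo t → ((e : Edge t) → ColorAtMostOne P e) →
                                          AtMostOneCrossingBelow t
  colorAtMostOne⇒atMostOneCrossingBelow ph γ≤1 here        cA _ = ⊥-elim (Phylo⇒uncrossed ph cA)
  colorAtMostOne⇒atMostOneCrossingBelow ph γ≤1 (there m p) =
    colorAtMostOne⇒atMostOneCrossing (there m p , isThere m p) (γ≤1 (there m p , isThere m p))

  refine-phylo : {t : Tree n} → Phylo t → Phylo (refine t)
  refine-phylo {t} ph = record
    { leafSet     = λ x → ∈L⇒leafPos (∈L-resp-leaves↭ (↭-sym (refine-leaves↭ t)) (Phylo⇒∈L ph x))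
    ; leafUniq    = Unique⇒uniqueLeafPositions (refine t) (Unique-resp-↭ (↭-sym (refine-leaves↭ t)) unique)
    ; twoChildren = Branching⇒twoChildren (refine-branching t branching)
    }
    where
    unique : Unique (leaves t)
    unique = uniqueLeafPositions⇒Unique t (Phylo.leafUniq ph)
    branching : Branching t
    branching = twoChildren⇒Branching t (Phylo.twoChildren ph)

  refine-refines : (t : Tree n) → Refines (refine t) t
  refine-refines t p with refine-pos t p
  ... | q , e = q , λ x → subst (λ s → x ∈L subtree p ⇔ x ∈L s) (sym e)
                               (leaves↭⇒SameLeaves (↭-sym (refine-leaves↭ (subtree p))) x)

  rcompatible⇒colorAtMostOne : (t : Tree n) → RCompatible t P → (e : Edge t) → ColorAtMostOne P e
  rcompatible⇒colorAtMostOne t (t* , ph* , refines , compatible) e@(p , _) with refines p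
  ... | q , p≈q = atMostOneCrossing⇒colorAtMostOne e
                    (AtMostOneCrossing-resp-SameLeaves (SameLeaves-sym p≈q)
                      (compatible⇒atMostOneCrossing t* (Phylo.leafUniq ph*) compatible q))

  colorAtMostOne⇒rcompatible : {t : Tree n} → Phylo t → ((e : Edge t) → ColorAtMostOne P e) →
                               RCompatible t P
  colorAtMostOne⇒rcompatible {t} ph γ≤1 =
    refine t , refine-phylo ph , refine-refines t ,
    resolved⇒compatible (refine t)
      (refine-resolved t (colorAtMostOne⇒atMostOneCrossingBelow ph γ≤1) unique)
      (Unique-resp-↭ (↭-sym (refine-leaves↭ t)) unique)
      (Phylo⇒∈L (refine-phylo ph))
    where
    unique : Unique (leaves t)
    unique = uniqueLeafPositions⇒Unique t (Phylo.leafUniq ph)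

proposition7p3 : (n : ℕ) → 2 ≤ n → (t : Tree n) → Phylo t → (P : Fin n → ℕ) →
                 RCompatible t P ⇔ ((e : Edge t) → ColorAtMostOne P e)
proposition7p3 n _ t ph P = mk⇔ (rcompatible⇒colorAtMostOne t) (colorAtMostOne⇒rcompatible ph)
  where open Blocks P
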